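{- As identities of formal power series in $z$, $$\mathrm{Li}_1(z)=\sum_{j=1}^{\infty}(-1)^{j-1}H_j\frac{z^j}{(1-z)^{j+1}},\qquad \mathrm{Li}_2(z)=\sum_{j=1}^{\infty}\frac{(-1)^{j-1}}{2}\left(H_j^2+H_j^{(2)}\right)\frac{z^j}{(1-z)^{j+1}},$$ $$\mathrm{Li}_3(z)=\sum_{j=1}^{\infty}\frac{(-1)^{j-1}}{6}\left(H_j^3+3H_jH_j^{(2)}+2H_j^{(3)}\right)\frac{z^j}{(1-z)^{j+1}},$$ $$\mathrm{Li}_4(z)=\sum_{j=1}^{\infty}\frac{(-1)^{j-1}}{24}\left(H_j^4+6H_j^2H_j^{(2)}+3\left(H_j^{(2)}\right)^2+8H_jH_j^{(3)}+6H_j^{(4)}\right)\frac{z^j}{(1-z)^{j+1}}.$$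
   Context: $\mathrm{Li}_s(z)=\sum_{n\ge1} z^n/n^s$ is the polylogarithm. For real $r$ and integer $n\ge0$, $H_n^{(r)}=\sum_{i=1}^{n} i^{ -r}$ and $H_n=H_n^{(1)}$. Each term $z^j/(1-z)^{j+1}$ is expanded as a formal power series with lowest-degree term $z^j$, so the sums are well defined. -}

module Defs where

open import Data.Nat as ℕ using (ℕ; zero; suc)
open import Data.Integer using (+_)
open import Data.Rational using (ℚ; 0ℚ; 1ℚ; _+_; _*_; _/_; -_)

infixr 8 _^ℚ_
_^ℚ_ : ℚ → ℕ → ℚ
q ^ℚ zero = 1ℚ
q ^ℚ suc k = q * (q ^ℚ k)

Σ₁ : ℕ → (ℕ → ℚ) → ℚ
Σ₁ zero f = 0ℚ
Σ₁ (suc n) f = Σ₁ n f + f (suc n)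

Σ₀ : ℕ → (ℕ → ℚ) → ℚ
Σ₀ zero f = f zero
Σ₀ (suc n) f = Σ₀ n f + f (suc n)

H[_] : ℕ → ℕ → ℚ
H[ r ] n = Σ₁ n (λ { zero → 0ℚ ; (suc i) → (+ 1 / suc i) ^ℚ r })

H : ℕ → ℚ
H = H[ 1 ]

sgn : ℕ → ℚ
sgn zero = 1ℚ
sgn (suc k) = - sgn k

FPS : Set
FPS = ℕ → ℚ

_·_ : FPS → FPS → FPS
(f · g) n = Σ₀ n (λ k → f k * g (n ℕ.∸ k))

one : FPS
one zero = 1ℚ
one (suc n) = 0ℚ

_^F_ : FPS → ℕ → FPS
f ^F zero = one
f ^F suc k = f · (f ^F k)

zF : FPS
zF (suc zero) = 1ℚ
zF _ = 0ℚ

-- 1/(1-z) = Σ_{n≥0} z^n  (the multiplicative inverse of 1 - z)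
inv1-z : FPS
inv1-z n = 1ℚ

T : ℕ → FPS
T j = (zF ^F j) · (inv1-z ^F suc j)

-- Σ_{j≥1} a_j z^j/(1-z)^{j+1}; well defined since T j has lowest-degree term z^j,
-- so the coefficient of z^n only receives contributions from j ≤ n.
ΣT : (ℕ → ℚ) → FPS
ΣT a n = Σ₁ n (λ j → a j * T j n)

Li : ℕ → FPS
Li s zero = 0ℚ
Li s (suc m) = (+ 1 / suc m) ^ℚ s

-- T j n is the binomial coefficient C(n, j): it obeys Pascal's rule and the absorption identity
-- (j+1) C(n+1, j+1) = (n+1) C(n, j).  Let h_s(j) be the complete homogeneous symmetric polynomial
-- of degree s in 1, 1/2, …, 1/j.  Then Σ_{j=1}^{n} (-1)^(j-1) C(n, j) h_s(j) = 1/n^s, by induction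
-- on s: Pascal's rule collapses the sum at n+1 to Σ_i (-1)^i C(n, i) h_{s-1}(i+1)/(i+1), and
-- absorption turns this into 1/(n+1) times the sum for s-1.  Newton's identities express h_1, …, h_4
-- through the power sums H_j^(r), giving the four coefficient sequences.

module Submission where

open import Defs
open import Data.Nat using (ℕ; suc)
import Data.Nat
open import Data.Integer using (+_)
open import Data.Rational using (ℚ; _+_; _*_; _/_)
open import Data.Product using (_×_)
open import Relation.Binary.PropositionalEquality using (_≡_)

open import Algebra.Bundles using (CommutativeMonoid)
import Algebra.Properties.CommutativeSemigroup as CommutativeSemigroupProperties
open import Data.Integer using (1ℤ)
import Data.Integer as ℤ
open import Data.Integer.Tactic.RingSolver using (solve-∀)
open import Data.Nat using (zero; _≤_; _<_; z≤n; s≤s; _∸_)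
import Data.Nat.Properties as ℕ
open import Data.Product using (_,_)
open import Data.Rational using (0ℚ; 1ℚ; -_; _-_; toℚᵘ; +-0-rawMonoid)
open import Data.Rational.Properties
open import Data.Rational.Solver using (module +-*-Solver)
import Data.Rational.Unnormalised as ℚᵘ
import Data.Rational.Unnormalised.Properties as ℚᵘ
open import Data.Vec.N-ary using (N-ary)
open import Algebra.Definitions.RawMonoid +-0-rawMonoid using () renaming (_×_ to _×ℚ_)
open import Relation.Binary.PropositionalEquality using (refl; sym; trans; cong; cong₂; module ≡-Reasoning)

open ≡-Reasoning
open +-*-Solver
open CommutativeSemigroupProperties (CommutativeMonoid.commutativeSemigroup +-0-commutativeMonoid)
  using (interchange)

Σ₀-cong : ∀ n {F G : ℕ → ℚ} → (∀ k → k ≤ n → F k ≡ G k) → Σ₀ n F ≡ Σ₀ n G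
Σ₀-cong zero     F≡G = F≡G 0 z≤n
Σ₀-cong (suc n) F≡G = cong₂ _+_ (Σ₀-cong n (λ k k≤n → F≡G k (ℕ.m≤n⇒m≤1+n k≤n))) (F≡G (suc n) ℕ.≤-refl)

Σ₁-cong : ∀ n {F G : ℕ → ℚ} → (∀ k → F (suc k) ≡ G (suc k)) → Σ₁ n F ≡ Σ₁ n G
Σ₁-cong zero    F≡G = refl
Σ₁-cong (suc n) F≡G = cong₂ _+_ (Σ₁-cong n F≡G) (F≡G n)

Σ₀-unfoldˡ : ∀ n (F : ℕ → ℚ) → Σ₀ (suc n) F ≡ F 0 + Σ₀ n (λ k → F (suc k))
Σ₀-unfoldˡ zero    F = refl
Σ₀-unfoldˡ (suc n) F = trans (cong (_+ F (suc (suc n))) (Σ₀-unfoldˡ n F)) (+-assoc (F 0) _ _)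

Σ₁-suc : ∀ n (F : ℕ → ℚ) → Σ₁ (suc n) F ≡ Σ₀ n (λ k → F (suc k))
Σ₁-suc zero    F = +-identityˡ (F 1)
Σ₁-suc (suc n) F = cong (_+ F (suc (suc n))) (Σ₁-suc n F)

Σ₀≡head+Σ₁ : ∀ n (F : ℕ → ℚ) → Σ₀ n F ≡ F 0 + Σ₁ n F
Σ₀≡head+Σ₁ zero    F = sym (+-identityʳ (F 0))
Σ₀≡head+Σ₁ (suc n) F = trans (cong (_+ F (suc n)) (Σ₀≡head+Σ₁ n F)) (+-assoc (F 0) _ _)

Σ₀-distrib-+ : ∀ n (F G : ℕ → ℚ) → Σ₀ n (λ k → F k + G k) ≡ Σ₀ n F + Σ₀ n G
Σ₀-distrib-+ zero    F G = refl
Σ₀-distrib-+ (suc n) F G =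
  trans (cong (_+ (F (suc n) + G (suc n))) (Σ₀-distrib-+ n F G)) (interchange (Σ₀ n F) (Σ₀ n G) (F (suc n)) (G (suc n)))

Σ₀-distribˡ-* : ∀ n c (F : ℕ → ℚ) → Σ₀ n (λ k → c * F k) ≡ c * Σ₀ n F
Σ₀-distribˡ-* zero    c F = refl
Σ₀-distribˡ-* (suc n) c F =
  trans (cong (_+ (c * F (suc n))) (Σ₀-distribˡ-* n c F)) (sym (*-distribˡ-+ c _ _))

Σ₁-neg : ∀ n (F : ℕ → ℚ) → Σ₁ n (λ k → - F k) ≡ - Σ₁ n F
Σ₁-neg zero    F = refl
Σ₁-neg (suc n) F = trans (cong (_+ (- F (suc n))) (Σ₁-neg n F)) (sym (neg-distrib-+ (Σ₁ n F) _))

Σ₀-zero : ∀ n {F : ℕ → ℚ} → (∀ k → F k ≡ 0ℚ) → Σ₀ n F ≡ 0ℚ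
Σ₀-zero zero    F≡0 = F≡0 0
Σ₀-zero (suc n) F≡0 = cong₂ _+_ (Σ₀-zero n F≡0) (F≡0 (suc n))

toℚᵘ-×ℚ-1ℚ : ∀ n → toℚᵘ (n ×ℚ 1ℚ) ℚᵘ.≃ ℚᵘ.mkℚᵘ (+ n) 0
toℚᵘ-×ℚ-1ℚ zero    = ℚᵘ.≃-refl
toℚᵘ-×ℚ-1ℚ (suc n) = ℚᵘ.≃-trans (toℚᵘ-homo-+ 1ℚ (n ×ℚ 1ℚ))
  (ℚᵘ.≃-trans (ℚᵘ.+-congʳ ℚᵘ.1ℚᵘ (toℚᵘ-×ℚ-1ℚ n)) (ℚᵘ.*≡* (cross-multiplication (+ n))))
  where
  cross-multiplication : ∀ i → (1ℤ ℤ.* 1ℤ ℤ.+ i ℤ.* 1ℤ) ℤ.* 1ℤ ≡ (1ℤ ℤ.+ i) ℤ.* (1ℤ ℤ.* 1ℤ)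
  cross-multiplication = solve-∀

1/[1+m]*[1+m]≡1 : ∀ m → (+ 1 / suc m) * (suc m ×ℚ 1ℚ) ≡ 1ℚ
1/[1+m]*[1+m]≡1 m = toℚᵘ-injective (ℚᵘ.≃-trans (toℚᵘ-homo-* (+ 1 / suc m) (suc m ×ℚ 1ℚ))
  (ℚᵘ.≃-trans (ℚᵘ.*-cong (toℚᵘ-fromℚᵘ (ℚᵘ.mkℚᵘ (+ 1) m)) (toℚᵘ-×ℚ-1ℚ (suc m)))
              (ℚᵘ.*-inverseˡ (ℚᵘ.mkℚᵘ (+ suc m) 0))))

·-identityˡ : ∀ f n → (one · f) n ≡ f n
·-identityˡ f zero    = *-identityˡ (f 0)
·-identityˡ f (suc n) = begin
  Σ₀ (suc n) (λ k → one k * f (suc n ∸ k))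
    ≡⟨ Σ₀-unfoldˡ n _ ⟩
  1ℚ * f (suc n) + Σ₀ n (λ k → 0ℚ * f (n ∸ k))
    ≡⟨ cong₂ _+_ (*-identityˡ (f (suc n))) (Σ₀-zero n (λ k → *-zeroˡ (f (n ∸ k)))) ⟩
  f (suc n) + 0ℚ
    ≡⟨ +-identityʳ (f (suc n)) ⟩
  f (suc n)
    ∎

zF·-suc : ∀ f n → (zF · f) (suc n) ≡ f n
zF·-suc f n = begin
  Σ₀ (suc n) (λ k → zF k * f (suc n ∸ k))
    ≡⟨ Σ₀-unfoldˡ n _ ⟩
  0ℚ * f (suc n) + Σ₀ n (λ k → zF (suc k) * f (n ∸ k))
    ≡⟨ cong₂ _+_ (*-zeroˡ (f (suc n))) (Σ₀-cong n (λ k _ → cong (_* f (n ∸ k)) (zF-suc k))) ⟩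
  0ℚ + (one · f) n
    ≡⟨ +-identityˡ ((one · f) n) ⟩
  (one · f) n
    ≡⟨ ·-identityˡ f n ⟩
  f n
    ∎
  where
  zF-suc : ∀ k → zF (suc k) ≡ one k
  zF-suc zero    = refl
  zF-suc (suc k) = refl

[zF·f]·g-zero : ∀ f g → ((zF · f) · g) 0 ≡ 0ℚ
[zF·f]·g-zero f g = trans (cong (_* g 0) (*-zeroˡ (f 0))) (*-zeroˡ (g 0))

[zF·f]·g-suc : ∀ f g n → ((zF · f) · g) (suc n) ≡ (f · g) n
[zF·f]·g-suc f g n = begin
  Σ₀ (suc n) (λ k → (zF · f) k * g (suc n ∸ k))                          ≡⟨ Σ₀-unfoldˡ n _ ⟩
  (zF · f) 0 * g (suc n) + Σ₀ n (λ k → (zF · f) (suc k) * g (n ∸ k))     ≡⟨ cong₂ _+_ head tail ⟩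
  0ℚ + (f · g) n                                                          ≡⟨ +-identityˡ ((f · g) n) ⟩
  (f · g) n                                                               ∎
  where
  head : (zF · f) 0 * g (suc n) ≡ 0ℚ
  head = trans (cong (_* g (suc n)) (*-zeroˡ (f 0))) (*-zeroˡ (g (suc n)))
  tail : Σ₀ n (λ k → (zF · f) (suc k) * g (n ∸ k)) ≡ (f · g) n
  tail = Σ₀-cong n (λ k _ → cong (_* g (n ∸ k)) (zF·-suc f k))

inv1-z·-suc : ∀ g m → (inv1-z · g) (suc m) ≡ g (suc m) + (inv1-z · g) m
inv1-z·-suc g m = trans (Σ₀-unfoldˡ m _) (cong (_+ Σ₀ m (λ k → 1ℚ * g (m ∸ k))) (*-identityˡ (g (suc m))))

·[inv1-z·g]-zero : ∀ f g → (f · (inv1-z · g)) 0 ≡ (f · g) 0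
·[inv1-z·g]-zero f g = cong (f 0 *_) (*-identityˡ (g 0))

·[inv1-z·g]-suc : ∀ f g n → (f · (inv1-z · g)) (suc n) ≡ (f · (inv1-z · g)) n + (f · g) (suc n)
·[inv1-z·g]-suc f g n = begin
  Σ₀ n (λ k → f k * G (suc n ∸ k)) + f (suc n) * G (n ∸ n)
    ≡⟨ cong₂ _+_ (Σ₀-cong n split) (cong (f (suc n) *_) (G≡g (ℕ.n∸n≡0 n))) ⟩
  Σ₀ n (λ k → f k * G (n ∸ k) + f k * g (suc n ∸ k)) + f (suc n) * g (n ∸ n)
    ≡⟨ cong (_+ f (suc n) * g (n ∸ n)) (Σ₀-distrib-+ n _ _) ⟩
  ((f · G) n + Σ₀ n (λ k → f k * g (suc n ∸ k))) + f (suc n) * g (n ∸ n)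
    ≡⟨ +-assoc ((f · G) n) _ _ ⟩
  (f · G) n + (f · g) (suc n)
    ∎
  where
  G : FPS
  G = inv1-z · g
  G≡g : ∀ {m} → m ≡ 0 → G m ≡ g m
  G≡g refl = *-identityˡ (g 0)
  split : ∀ k → k ≤ n → f k * G (suc n ∸ k) ≡ f k * G (n ∸ k) + f k * g (suc n ∸ k)
  split k k≤n rewrite ℕ.+-∸-assoc 1 k≤n = begin
    f k * G (suc (n ∸ k))                          ≡⟨ cong (f k *_) (inv1-z·-suc g (n ∸ k)) ⟩
    f k * (g (suc (n ∸ k)) + G (n ∸ k))            ≡⟨ cong (f k *_) (+-comm (g (suc (n ∸ k))) (G (n ∸ k))) ⟩
    f k * (G (n ∸ k) + g (suc (n ∸ k)))            ≡⟨ *-distribˡ-+ (f k) (G (n ∸ k)) (g (suc (n ∸ k))) ⟩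
    f k * G (n ∸ k) + f k * g (suc (n ∸ k))        ∎

T-zero : ∀ n → T 0 n ≡ 1ℚ
T-zero zero    = refl
T-zero (suc n) = begin
  T 0 (suc n)                ≡⟨ ·[inv1-z·g]-suc one one n ⟩
  T 0 n + (one · one) (suc n) ≡⟨ cong₂ _+_ (T-zero n) (·-identityˡ one (suc n)) ⟩
  1ℚ + 0ℚ                    ≡⟨ +-identityʳ 1ℚ ⟩
  1ℚ                         ∎

T-suc-zero : ∀ j → T (suc j) 0 ≡ 0ℚ
T-suc-zero j = [zF·f]·g-zero (zF ^F j) (inv1-z ^F suc (suc j))

T-pascal : ∀ j n → T (suc j) (suc n) ≡ T (suc j) n + T j n
T-pascal j zero = begin
  T (suc j) 1           ≡⟨ [zF·f]·g-suc zⱼ (inv1-z ^F suc (suc j)) 0 ⟩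
  (zⱼ · (inv1-z · Iⱼ)) 0  ≡⟨ ·[inv1-z·g]-zero zⱼ Iⱼ ⟩
  T j 0                 ≡⟨ +-identityˡ (T j 0) ⟨
  0ℚ + T j 0            ≡⟨ cong (_+ T j 0) (T-suc-zero j) ⟨
  T (suc j) 0 + T j 0   ∎
  where
  zⱼ Iⱼ : FPS
  zⱼ = zF ^F j
  Iⱼ = inv1-z ^F suc j
T-pascal j (suc n) = begin
  T (suc j) (suc (suc n))                     ≡⟨ [zF·f]·g-suc zⱼ (inv1-z ^F suc (suc j)) (suc n) ⟩
  (zⱼ · (inv1-z · Iⱼ)) (suc n)                ≡⟨ ·[inv1-z·g]-suc zⱼ Iⱼ n ⟩
  (zⱼ · (inv1-z · Iⱼ)) n + T j (suc n)        ≡⟨ cong (_+ T j (suc n)) ([zF·f]·g-suc zⱼ (inv1-z ^F suc (suc j)) n) ⟨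
  T (suc j) (suc n) + T j (suc n)             ∎
  where
  zⱼ Iⱼ : FPS
  zⱼ = zF ^F j
  Iⱼ = inv1-z ^F suc j

T-below-diagonal : ∀ {j n} → n < j → T j n ≡ 0ℚ
T-below-diagonal {suc j} {zero}  _           = T-suc-zero j
T-below-diagonal {suc j} {suc n} (s≤s n<j) =
  trans (T-pascal j n) (cong₂ _+_ (T-below-diagonal (ℕ.m<n⇒m<1+n n<j)) (T-below-diagonal n<j))

-- n ×ℚ 1ℚ is n as a rational; suc n ×ℚ 1ℚ reduces to 1ℚ + n ×ℚ 1ℚ, so the ring solver sees 1 + N.
T-absorption : ∀ j n → (suc j ×ℚ 1ℚ) * T (suc j) (suc n) ≡ (suc n ×ℚ 1ℚ) * T j n
T-absorption-step : ∀ j n →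
  (suc n ×ℚ 1ℚ) * T j n + (suc j ×ℚ 1ℚ) * T j (suc n) ≡ (suc (suc n) ×ℚ 1ℚ) * T j (suc n)

T-absorption j zero = trans (cong ((suc j ×ℚ 1ℚ) *_) T[1+j,1]≡T[j,0]) (edge j)
  where
  T[1+j,1]≡T[j,0] : T (suc j) 1 ≡ T j 0
  T[1+j,1]≡T[j,0] = trans (T-pascal j 0) (trans (cong (_+ T j 0) (T-suc-zero j)) (+-identityˡ (T j 0)))
  edge : ∀ j → (suc j ×ℚ 1ℚ) * T j 0 ≡ (1 ×ℚ 1ℚ) * T j 0
  edge zero    = refl
  edge (suc j) rewrite T-suc-zero j = trans (*-zeroʳ (suc (suc j) ×ℚ 1ℚ)) (sym (*-zeroʳ (1 ×ℚ 1ℚ)))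
T-absorption j (suc n) = begin
  J₁ * T (suc j) (suc (suc n))                 ≡⟨ cong (J₁ *_) (T-pascal j (suc n)) ⟩
  J₁ * (T (suc j) (suc n) + T j (suc n))       ≡⟨ *-distribˡ-+ J₁ (T (suc j) (suc n)) (T j (suc n)) ⟩
  J₁ * T (suc j) (suc n) + J₁ * T j (suc n)    ≡⟨ cong (_+ J₁ * T j (suc n)) (T-absorption j n) ⟩
  (suc n ×ℚ 1ℚ) * T j n + J₁ * T j (suc n)     ≡⟨ T-absorption-step j n ⟩
  (suc (suc n) ×ℚ 1ℚ) * T j (suc n)            ∎
  where
  J₁ : ℚ
  J₁ = suc j ×ℚ 1ℚ

T-absorption-step zero n rewrite T-zero n | T-zero (suc n) =
  solve 1 (λ N → (con 1ℚ :+ N) :* con 1ℚ :+ (con 1ℚ :+ con 0ℚ) :* con 1ℚ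
               := (con 1ℚ :+ (con 1ℚ :+ N)) :* con 1ℚ) refl (n ×ℚ 1ℚ)
T-absorption-step (suc j) n = begin
  N₁ * a + (1ℚ + J₁) * c
    ≡⟨ solve 4 (λ N₁ J₁ a c → N₁ :* a :+ (con 1ℚ :+ J₁) :* c := N₁ :* a :+ c :+ J₁ :* c) refl N₁ J₁ a c ⟩
  N₁ * a + c + J₁ * c
    ≡⟨ cong (λ x → N₁ * a + c + x) (T-absorption j n) ⟩
  N₁ * a + c + N₁ * b
    ≡⟨ solve 4 (λ N₁ a b c → N₁ :* a :+ c :+ N₁ :* b := N₁ :* (a :+ b) :+ c) refl N₁ a b c ⟩
  N₁ * (a + b) + c
    ≡⟨ cong (λ x → N₁ * x + c) (T-pascal j n) ⟨
  N₁ * c + c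
    ≡⟨ solve 2 (λ N₁ c → N₁ :* c :+ c := (con 1ℚ :+ N₁) :* c) refl N₁ c ⟩
  (1ℚ + N₁) * c
    ∎
  where
  N₁ J₁ a b c : ℚ
  N₁ = suc n ×ℚ 1ℚ
  J₁ = suc j ×ℚ 1ℚ
  a = T (suc j) n
  b = T j n
  c = T (suc j) (suc n)

T-absorption-/ : ∀ i n → (+ 1 / suc i) * T i n ≡ (+ 1 / suc n) * T (suc i) (suc n)
T-absorption-/ i n = begin
  u * t                 ≡⟨ cong (u *_) (*-identityˡ t) ⟨
  u * (1ℚ * t)          ≡⟨ cong (λ x → u * (x * t)) (1/[1+m]*[1+m]≡1 n) ⟨
  u * ((v * N₁) * t)    ≡⟨ solve 4 (λ u v N₁ t → u :* ((v :* N₁) :* t) := u :* v :* (N₁ :* t)) refl u v N₁ t ⟩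
  u * v * (N₁ * t)      ≡⟨ cong (u * v *_) (T-absorption i n) ⟨
  u * v * (I₁ * t′)     ≡⟨ solve 5 (λ u v I₁ t t′ → u :* v :* (I₁ :* t′) := (u :* I₁) :* (v :* t′)) refl u v I₁ t t′ ⟩
  (u * I₁) * (v * t′)   ≡⟨ cong (_* (v * t′)) (1/[1+m]*[1+m]≡1 i) ⟩
  1ℚ * (v * t′)         ≡⟨ *-identityˡ (v * t′) ⟩
  v * t′                ∎
  where
  u v I₁ N₁ t t′ : ℚ
  u = + 1 / suc i
  v = + 1 / suc n
  I₁ = suc i ×ℚ 1ℚ
  N₁ = suc n ×ℚ 1ℚ
  t = T i n
  t′ = T (suc i) (suc n)

alternating : (ℕ → ℚ) → ℕ → ℚ
alternating g j = sgn (j ∸ 1) * g j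

ΣT-pascal : ∀ a n → ΣT a (suc n) ≡ ΣT a n + Σ₀ n (λ i → a (suc i) * T i n)
ΣT-pascal a n = begin
  ΣT a (suc n)
    ≡⟨ Σ₁-suc n (λ j → a j * T j (suc n)) ⟩
  Σ₀ n (λ i → a (suc i) * T (suc i) (suc n))
    ≡⟨ Σ₀-cong n (λ i _ → pascal i) ⟩
  Σ₀ n (λ i → a (suc i) * T (suc i) n + a (suc i) * T i n)
    ≡⟨ Σ₀-distrib-+ n _ _ ⟩
  Σ₀ n (λ i → a (suc i) * T (suc i) n) + Σ₀ n (λ i → a (suc i) * T i n)
    ≡⟨ cong (_+ Σ₀ n (λ i → a (suc i) * T i n)) diagonal ⟩
  ΣT a n + Σ₀ n (λ i → a (suc i) * T i n)
    ∎
  where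
  pascal : ∀ i → a (suc i) * T (suc i) (suc n) ≡ a (suc i) * T (suc i) n + a (suc i) * T i n
  pascal i = trans (cong (a (suc i) *_) (T-pascal i n)) (*-distribˡ-+ (a (suc i)) _ _)
  diagonal : Σ₀ n (λ i → a (suc i) * T (suc i) n) ≡ ΣT a n
  diagonal = begin
    Σ₀ n (λ i → a (suc i) * T (suc i) n)     ≡⟨ Σ₁-suc n (λ j → a j * T j n) ⟨
    ΣT a n + a (suc n) * T (suc n) n         ≡⟨ cong (λ x → ΣT a n + a (suc n) * x) (T-below-diagonal (ℕ.n<1+n n)) ⟩
    ΣT a n + a (suc n) * 0ℚ                  ≡⟨ cong (_+_ (ΣT a n)) (*-zeroʳ (a (suc n))) ⟩
    ΣT a n + 0ℚ                              ≡⟨ +-identityʳ (ΣT a n) ⟩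
    ΣT a n                                   ∎

Σ₀-sgn≡head-ΣT-alternating : ∀ g n → Σ₀ n (λ i → sgn i * g i * T i n) ≡ g 0 - ΣT (alternating g) n
Σ₀-sgn≡head-ΣT-alternating g n = begin
  Σ₀ n F                                              ≡⟨ Σ₀≡head+Σ₁ n F ⟩
  1ℚ * g 0 * T 0 n + Σ₁ n F                           ≡⟨ cong₂ _+_ head (Σ₁-cong n tail) ⟩
  g 0 + Σ₁ n (λ j → - (alternating g j * T j n))      ≡⟨ cong (_+_ (g 0)) (Σ₁-neg n (λ j → alternating g j * T j n)) ⟩
  g 0 - ΣT (alternating g) n                          ∎
  where
  F : ℕ → ℚ
  F i = sgn i * g i * T i n
  head : 1ℚ * g 0 * T 0 n ≡ g 0
  head = trans (cong (1ℚ * g 0 *_) (T-zero n)) (trans (*-identityʳ (1ℚ * g 0)) (*-identityˡ (g 0)))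
  tail : ∀ k → - sgn k * g (suc k) * T (suc k) n ≡ - (sgn k * g (suc k) * T (suc k) n)
  tail k = trans (cong (_* T (suc k) n) (sym (neg-distribˡ-* (sgn k) (g (suc k)))))
                 (sym (neg-distribˡ-* (sgn k * g (suc k)) (T (suc k) n)))

ΣT-alternating-difference : ∀ (g d : ℕ → ℚ) → (∀ i → g (suc i) ≡ g i + d i) → ∀ n →
  ΣT (alternating g) (suc n) ≡ g 0 + Σ₀ n (λ i → sgn i * d i * T i n)
ΣT-alternating-difference g d g-step n = begin
  ΣT (alternating g) (suc n)
    ≡⟨ ΣT-pascal (alternating g) n ⟩
  B + Σ₀ n (λ i → sgn i * g (suc i) * T i n)
    ≡⟨ cong (_+_ B) (Σ₀-cong n (λ i _ → split i)) ⟩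
  B + Σ₀ n (λ i → G i + D i)
    ≡⟨ cong (_+_ B) (Σ₀-distrib-+ n G D) ⟩
  B + (Σ₀ n G + Σ₀ n D)
    ≡⟨ cong (λ x → B + (x + Σ₀ n D)) (Σ₀-sgn≡head-ΣT-alternating g n) ⟩
  B + ((g 0 - B) + Σ₀ n D)
    ≡⟨ solve 3 (λ B g₀ Δ → B :+ ((g₀ :- B) :+ Δ) := g₀ :+ Δ) refl B (g 0) (Σ₀ n D) ⟩
  g 0 + Σ₀ n D
    ∎
  where
  B : ℚ
  B = ΣT (alternating g) n
  G D : ℕ → ℚ
  G i = sgn i * g i * T i n
  D i = sgn i * d i * T i n
  split : ∀ i → sgn i * g (suc i) * T i n ≡ G i + D i
  split i = begin
    sgn i * g (suc i) * T i n             ≡⟨ cong (λ x → sgn i * x * T i n) (g-step i) ⟩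
    sgn i * (g i + d i) * T i n           ≡⟨ cong (_* T i n) (*-distribˡ-+ (sgn i) (g i) (d i)) ⟩
    (sgn i * g i + sgn i * d i) * T i n   ≡⟨ *-distribʳ-+ (T i n) (sgn i * g i) (sgn i * d i) ⟩
    G i + D i                             ∎

-- h[ s ] j = h_s(1, 1/2, …, 1/j), the complete homogeneous symmetric polynomial of degree s.
h[_] : ℕ → ℕ → ℚ
h[ zero  ] j       = 1ℚ
h[ suc s ] zero    = 0ℚ
h[ suc s ] (suc j) = h[ suc s ] j + h[ s ] (suc j) * (+ 1 / suc j)

ΣT-alternating-h : ∀ s n → ΣT (alternating h[ s ]) (suc n) ≡ (+ 1 / suc n) ^ℚ s
ΣT-alternating-h zero n = begin
  ΣT (alternating h[ 0 ]) (suc n)            ≡⟨ ΣT-alternating-difference h[ 0 ] (λ _ → 0ℚ) (λ _ → refl) n ⟩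
  1ℚ + Σ₀ n (λ i → sgn i * 0ℚ * T i n)       ≡⟨ cong (_+_ 1ℚ) (Σ₀-zero n vanish) ⟩
  1ℚ                                         ∎
  where
  vanish : ∀ i → sgn i * 0ℚ * T i n ≡ 0ℚ
  vanish i = trans (cong (_* T i n) (*-zeroʳ (sgn i))) (*-zeroˡ (T i n))
ΣT-alternating-h (suc s) n = begin
  ΣT (alternating h[ suc s ]) (suc n)
    ≡⟨ ΣT-alternating-difference h[ suc s ] d (λ _ → refl) n ⟩
  0ℚ + Σ₀ n (λ i → sgn i * d i * T i n)
    ≡⟨ +-identityˡ (Σ₀ n (λ i → sgn i * d i * T i n)) ⟩
  Σ₀ n (λ i → sgn i * d i * T i n)
    ≡⟨ Σ₀-cong n (λ i _ → absorb i) ⟩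
  Σ₀ n (λ i → v * (alternating h[ s ] (suc i) * T (suc i) (suc n)))
    ≡⟨ Σ₀-distribˡ-* n v _ ⟩
  v * Σ₀ n (λ i → alternating h[ s ] (suc i) * T (suc i) (suc n))
    ≡⟨ cong (v *_) (Σ₁-suc n (λ j → alternating h[ s ] j * T j (suc n))) ⟨
  v * ΣT (alternating h[ s ]) (suc n)
    ≡⟨ cong (v *_) (ΣT-alternating-h s n) ⟩
  v * v ^ℚ s
    ∎
  where
  v : ℚ
  v = + 1 / suc n
  d : ℕ → ℚ
  d i = h[ s ] (suc i) * (+ 1 / suc i)
  absorb : ∀ i → sgn i * d i * T i n ≡ v * (sgn i * h[ s ] (suc i) * T (suc i) (suc n))
  absorb i = begin
    sgn i * (h[ s ] (suc i) * (+ 1 / suc i)) * T i n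
      ≡⟨ solve 4 (λ σ h u t → σ :* (h :* u) :* t := σ :* h :* (u :* t)) refl (sgn i) (h[ s ] (suc i)) (+ 1 / suc i) (T i n) ⟩
    sgn i * h[ s ] (suc i) * ((+ 1 / suc i) * T i n)
      ≡⟨ cong (sgn i * h[ s ] (suc i) *_) (T-absorption-/ i n) ⟩
    sgn i * h[ s ] (suc i) * (v * T (suc i) (suc n))
      ≡⟨ solve 4 (λ σ h v t → σ :* h :* (v :* t) := v :* (σ :* h :* t)) refl (sgn i) (h[ s ] (suc i)) v (T (suc i) (suc n)) ⟩
    v * (sgn i * h[ s ] (suc i) * T (suc i) (suc n))
      ∎

Li≡ΣT-alternating-h : ∀ s n → Li s n ≡ ΣT (alternating h[ s ]) n
Li≡ΣT-alternating-h s zero    = refl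
Li≡ΣT-alternating-h s (suc n) = sym (ΣT-alternating-h s n)

h[suc]-by-recurrence : ∀ s (P Q : ℕ → ℚ) → (∀ j → h[ s ] j ≡ P j) → Q 0 ≡ 0ℚ →
  (∀ j → Q (suc j) ≡ Q j + P (suc j) * (+ 1 / suc j)) → ∀ j → h[ suc s ] j ≡ Q j
h[suc]-by-recurrence s P Q h≡P Q₀ Q-step zero    = sym Q₀
h[suc]-by-recurrence s P Q h≡P Q₀ Q-step (suc j) = begin
  h[ suc s ] j + h[ s ] (suc j) * (+ 1 / suc j)
    ≡⟨ cong₂ (λ a b → a + b * (+ 1 / suc j)) (h[suc]-by-recurrence s P Q h≡P Q₀ Q-step j) (h≡P (suc j)) ⟩
  Q j + P (suc j) * (+ 1 / suc j)
    ≡⟨ Q-step j ⟨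
  Q (suc j)
    ∎

-- Newton's identities: h_s as a polynomial in the power sums p_r = H[ r ] j.
PowerSumPolynomial : Set
PowerSumPolynomial = ∀ {m} → Polynomial m → Polynomial m → Polynomial m → Polynomial m → Polynomial m

newton₀ newton₁ newton₂ newton₃ newton₄ : PowerSumPolynomial
newton₀ p₁ p₂ p₃ p₄ = con 1ℚ
newton₁ p₁ p₂ p₃ p₄ = p₁
newton₂ p₁ p₂ p₃ p₄ = con (+ 1 / 2) :* (p₁ :^ 2 :+ p₂)
newton₃ p₁ p₂ p₃ p₄ = con (+ 1 / 6) :* (p₁ :^ 3 :+ con (+ 3 / 1) :* p₁ :* p₂ :+ con (+ 2 / 1) :* p₃)
newton₄ p₁ p₂ p₃ p₄ = con (+ 1 / 24) :* (p₁ :^ 4 :+ con (+ 6 / 1) :* p₁ :^ 2 :* p₂ :+ con (+ 3 / 1) :* p₂ :^ 2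
                                         :+ con (+ 8 / 1) :* p₁ :* p₃ :+ con (+ 6 / 1) :* p₄)

-- The defining recurrence of h[ s + 1 ] when the variable x = 1/(j+1) is adjoined, which raises
-- each p_r by x ^ r (also for r = 1, matching the definition of H[ 1 ]).
newton-recurrence : PowerSumPolynomial → PowerSumPolynomial → N-ary 5 (Polynomial 5) (Polynomial 5 × Polynomial 5)
newton-recurrence Pₛ Pₛ₊₁ p₁ p₂ p₃ p₄ x =
  Pₛ₊₁ (p₁ :+ x :^ 1) (p₂ :+ x :^ 2) (p₃ :+ x :^ 3) (p₄ :+ x :^ 4)
    := Pₛ₊₁ p₁ p₂ p₃ p₄ :+ Pₛ (p₁ :+ x :^ 1) (p₂ :+ x :^ 2) (p₃ :+ x :^ 3) (p₄ :+ x :^ 4) :* x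

h[1]≡H : ∀ j → h[ 1 ] j ≡ H j
h[1]≡H = h[suc]-by-recurrence 0 _ _ (λ _ → refl) refl λ j →
  solve 5 (newton-recurrence newton₀ newton₁) refl (H j) (H[ 2 ] j) (H[ 3 ] j) (H[ 4 ] j) (+ 1 / suc j)

h[2]≡ : ∀ j → h[ 2 ] j ≡ (+ 1 / 2) * (H j ^ℚ 2 + H[ 2 ] j)
h[2]≡ = h[suc]-by-recurrence 1 _ _ h[1]≡H refl λ j →
  solve 5 (newton-recurrence newton₁ newton₂) refl (H j) (H[ 2 ] j) (H[ 3 ] j) (H[ 4 ] j) (+ 1 / suc j)

h[3]≡ : ∀ j → h[ 3 ] j ≡ (+ 1 / 6) * (H j ^ℚ 3 + (+ 3 / 1) * H j * H[ 2 ] j + (+ 2 / 1) * H[ 3 ] j)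
h[3]≡ = h[suc]-by-recurrence 2 _ _ h[2]≡ refl λ j →
  solve 5 (newton-recurrence newton₂ newton₃) refl (H j) (H[ 2 ] j) (H[ 3 ] j) (H[ 4 ] j) (+ 1 / suc j)

h[4]≡ : ∀ j → h[ 4 ] j ≡ (+ 1 / 24) * (H j ^ℚ 4 + (+ 6 / 1) * H j ^ℚ 2 * H[ 2 ] j + (+ 3 / 1) * H[ 2 ] j ^ℚ 2
                                        + (+ 8 / 1) * H j * H[ 3 ] j + (+ 6 / 1) * H[ 4 ] j)
h[4]≡ = h[suc]-by-recurrence 3 _ _ h[3]≡ refl λ j →
  solve 5 (newton-recurrence newton₃ newton₄) refl (H j) (H[ 2 ] j) (H[ 3 ] j) (H[ 4 ] j) (+ 1 / suc j)

Li≡ΣT : ∀ s {P : ℕ → ℚ} → (∀ j → h[ s ] j ≡ P j) → ∀ n → Li s n ≡ ΣT (λ j → sgn (j ∸ 1) * P j) n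
Li≡ΣT s h≡P n = trans (Li≡ΣT-alternating-h s n) (Σ₁-cong n (λ j → cong (λ x → sgn j * x * T (suc j) n) (h≡P (suc j))))

Li≡ΣT-scaled : ∀ s c {P : ℕ → ℚ} → (∀ j → h[ s ] j ≡ c * P j) → ∀ n → Li s n ≡ ΣT (λ j → sgn (j ∸ 1) * c * P j) n
Li≡ΣT-scaled s c {P} h≡cP n = trans (Li≡ΣT s h≡cP n) (Σ₁-cong n (λ j → cong (_* T (suc j) n) (sym (*-assoc (sgn j) c (P (suc j))))))

corollary4p1 : (∀ n → Li 1 n ≡ ΣT (λ j → sgn (j Data.Nat.∸ 1) * H j) n)
    × (∀ n → Li 2 n ≡ ΣT (λ j → sgn (j Data.Nat.∸ 1) * (+ 1 / 2)
          * (H j ^ℚ 2 + H[ 2 ] j)) n)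
    × (∀ n → Li 3 n ≡ ΣT (λ j → sgn (j Data.Nat.∸ 1) * (+ 1 / 6)
          * (H j ^ℚ 3 + (+ 3 / 1) * H j * H[ 2 ] j + (+ 2 / 1) * H[ 3 ] j)) n)
    × (∀ n → Li 4 n ≡ ΣT (λ j → sgn (j Data.Nat.∸ 1) * (+ 1 / 24)
          * (H j ^ℚ 4 + (+ 6 / 1) * H j ^ℚ 2 * H[ 2 ] j + (+ 3 / 1) * H[ 2 ] j ^ℚ 2
             + (+ 8 / 1) * H j * H[ 3 ] j + (+ 6 / 1) * H[ 4 ] j)) n)
corollary4p1 =
    Li≡ΣT 1 h[1]≡H
  , Li≡ΣT-scaled 2 (+ 1 / 2) h[2]≡
  , Li≡ΣT-scaled 3 (+ 1 / 6) h[3]≡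
  , Li≡ΣT-scaled 4 (+ 1 / 24) h[4]≡
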